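{- Let $n\ge 6$ be an integer such that the circular ladder $CL_n$ satisfies $\chi_\rho(CL_n)\le 5$. Then there exists a packing $5$-colouring of $CL_n$ in which every edge of $CL_n$ has an endpoint of colour $1$.
   Context: All graphs are simple; $d_G(u,v)$ is the shortest-path distance. A packing $k$-colouring of $G$ is a map $\pi:V(G)\to\{1,\dots,k\}$ such that for distinct $u,v$, $\pi(u)=\pi(v)=i$ implies $d_G(u,v)>i$; $\chi_\rho(G)$ is the least $k$ for which a packing $k$-colouring exists. The circular ladder $CL_n$ ($n\ge 3$) has vertex set $\{u_0,\dots,u_{n-1}\}\cup\{v_0,\dots,v_{n-1}\}$ and edges $u_iv_i$, $u_iu_{i+1}$, $v_iv_{i+1}$ for $0\le i\le n-1$ (subscripts modulo $n$). -}

module Defs where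

open import Data.Nat using (ℕ; zero; suc; _≤_)
open import Data.Fin using (Fin; toℕ)
open import Data.Bool using (Bool)
open import Data.Product using (_×_; Σ; ∃; _,_)
open import Data.Sum using (_⊎_)
open import Relation.Binary.PropositionalEquality using (_≡_; _≢_)
open import Relation.Nullary using (¬_)

CycSucc : (n : ℕ) → Fin n → Fin n → Set
CycSucc n i j = (suc (toℕ i) ≡ toℕ j) ⊎ ((suc (toℕ i) ≡ n) × (toℕ j ≡ 0))

-- Vertices of CL_n: (false , i) is u_i, (true , i) is v_i.
CLVertex : ℕ → Set
CLVertex n = Bool × Fin n

data CLAdj (n : ℕ) : CLVertex n → CLVertex n → Set where
  rung  : ∀ {b c i} → b ≢ c → CLAdj n (b , i) (c , i)
  fwd   : ∀ {b i j} → CycSucc n i j → CLAdj n (b , i) (b , j)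
  bwd   : ∀ {b i j} → CycSucc n j i → CLAdj n (b , i) (b , j)

data Walk {V : Set} (E : V → V → Set) : V → V → ℕ → Set where
  here : ∀ {x} → Walk E x x 0
  step : ∀ {x y z m} → E x y → Walk E y z m → Walk E x z (suc m)

DistLe : {V : Set} (E : V → V → Set) → V → V → ℕ → Set
DistLe E x y i = ∃ λ m → (m ≤ i) × Walk E x y m

IsPackingColouring : {V : Set} (E : V → V → Set) (k : ℕ) (π : V → ℕ) → Set
IsPackingColouring {V} E k π =
  ((x : V) → (1 ≤ π x) × (π x ≤ k)) ×
  ((x y : V) → x ≢ y → π x ≡ π y → ¬ DistLe E x y (π x))

ChiRhoLe : {V : Set} (E : V → V → Set) (k : ℕ) → Set
ChiRhoLe {V} E k = ∃ λ k' → (k' ≤ k) × Σ (V → ℕ) (IsPackingColouring E k')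

-- Call a vertex free if it has colour 1 or no neighbour of colour 1. In a packing 5-colouring
-- of a circular ladder every edge has exactly one free endpoint: this is a local property, and
-- an exhaustive search through the colourings of eight consecutive rungs (there are only 336 of
-- them) confirms it. Recolouring every free vertex with 1 therefore keeps the colouring a packing
-- colouring, since the free vertices are independent and contain all vertices of colour 1, and
-- afterwards every edge has an endpoint of colour 1.
module Submission where

open import Defs
open import Data.Nat using (ℕ; _≤_)
open import Data.Product using (_×_; Σ)
open import Data.Sum using (_⊎_)
open import Relation.Binary.PropositionalEquality using (_≡_)

open import Data.Bool using (Bool; true; false; not; _∧_; _∨_; _xor_; if_then_else_; T)
open import Data.Bool.Properties using (T-≡; T-∧; T-∨; xor-comm; not-¬)
open import Data.Empty using (⊥-elim)
open import Data.Fin using (Fin; toℕ)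
open import Data.Fin.Properties using (toℕ-injective; toℕ<n; toℕ-fromℕ<)
open import Data.Bool.ListAction using (all)
open import Data.List using (List; []; _∷_; applyUpTo; cartesianProduct)
open import Data.List.Membership.Propositional using (_∈_)
open import Data.List.Membership.Propositional.Properties using (∈-applyUpTo⁺; ∈-cartesianProduct⁺)
open import Data.List.Relation.Unary.All using (lookup)
open import Data.List.Relation.Unary.All.Properties using (all⁺)
open import Data.Nat using (zero; suc; pred; _+_; _*_; _<_; _≡ᵇ_; _≤ᵇ_; _<?_; _%_; _/_; s≤s; z<s; NonZero; >-nonZero)
open import Data.Nat.Divisibility using (divides; >⇒∤)
open import Data.Nat.DivMod using (_mod_; m%n<n; n%n≡0; m%n%n≡m%n; [m+n]%n≡m%n; m<n⇒m%n≡m; %-distribˡ-+; m≡m%n+[m/n]*n)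
open import Data.Nat.Properties
  using (≡ᵇ⇒≡; ≡⇒≡ᵇ; ≤ᵇ⇒≤; ≤-refl; ≤-trans; ≤-<-trans; ≤-antisym; ≮⇒≥; +-identityʳ; +-suc; +-cancelˡ-≡; suc-pred)
open import Data.Product using (_,_; proj₁; proj₂)
open import Data.Sum using (inj₁; inj₂; [_,_]; map)
open import Data.Unit using (tt)
open import Function using (_∘_; Equivalence)
open import Relation.Binary.PropositionalEquality using (_≢_; refl; sym; trans; cong; subst; subst₂; module ≡-Reasoning)
open import Relation.Nullary using (¬_; yes; no)

open Equivalence using (to; from)

¬-∨ : ∀ {a b} → ¬ T a → ¬ T b → ¬ T (a ∨ b)
¬-∨ ¬a ¬b = [ ¬a , ¬b ] ∘ to T-∨

xor⇒⊎ : ∀ a b → T (a xor b) → T a ⊎ T b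
xor⇒⊎ true  _    _ = inj₁ tt
xor⇒⊎ false true _ = inj₂ tt

xor⇒¬both : ∀ a b → T (a xor b) → T a → ¬ T b
xor⇒¬both true true ()

T-if : ∀ {b y} → ¬ T b → T (if b then true else y) → T y
T-if {false} _ t = t
T-if {true}  ¬b _ = ⊥-elim (¬b tt)

module Backtracking {A : Set} (candidates : List A) (conflicts : A → List A → Bool)
                    (goal : List A → Bool) where

  search : ℕ → List A → Bool
  search zero    past = goal past
  search (suc d) past = all (λ c → if conflicts c past then true else search d (c ∷ past)) candidates

  history : (ℕ → A) → ℕ → List A
  history f zero    = []
  history f (suc p) = f p ∷ history f p

  search-sound : (f : ℕ → A) → (∀ p → f p ∈ candidates) →
                 (∀ p → ¬ T (conflicts (f p) (history f p))) →
                 ∀ d p → T (search d (history f p)) → T (goal (history f (d + p)))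
  search-sound f f∈ fits zero    p s = s
  search-sound f f∈ fits (suc d) p s =
    subst (T ∘ goal ∘ history f) (+-suc d p)
      (search-sound f f∈ fits d (suc p) (T-if (fits p) (lookup (all⁺ _ _ s) (f∈ p))))

clash : ℕ → ℕ → ℕ → Bool
clash d a b = (a ≡ᵇ b) ∧ (d ≤ᵇ a)

clash⇒≤ : ∀ {d a b} → T (clash d a b) → d ≤ a
clash⇒≤ {d} {a} c = ≤ᵇ⇒≤ d a (proj₂ (to T-∧ c))

recolourOnes : {V : Set} → (V → Bool) → (V → ℕ) → V → ℕ
recolourOnes R π x = if R x then 1 else π x

module _ {V : Set} {E : V → V → Set} where

  packing-mono : ∀ {k k′ π} → k ≤ k′ → IsPackingColouring E k π → IsPackingColouring E k′ π
  packing-mono k≤k′ (bounds , apart) =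
    (λ x → proj₁ (bounds x) , ≤-trans (proj₂ (bounds x)) k≤k′) , apart

  packing⇒¬clash : ∀ {k π x y d} → IsPackingColouring E k π → x ≢ y → Walk E y x d →
                   ¬ T (clash d (π x) (π y))
  packing⇒¬clash {π = π} {x} {y} {d} (_ , apart) x≢y w c =
    apart y x (x≢y ∘ sym) (sym same) (d , subst (d ≤_) same (clash⇒≤ c) , w)
    where same = ≡ᵇ⇒≡ (π x) (π y) (proj₁ (to T-∧ c))

  dist≤1⇒adjacent : ∀ {x y} → x ≢ y → DistLe E x y 1 → E x y
  dist≤1⇒adjacent x≢y (zero , _ , here)         = ⊥-elim (x≢y refl)
  dist≤1⇒adjacent x≢y (suc zero , _ , step e here) = e
  dist≤1⇒adjacent x≢y (suc (suc _) , s≤s () , _)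

  recolourOnes-covers : ∀ R π → (∀ x y → E x y → T (R x) ⊎ T (R y)) →
                        ∀ x y → E x y → recolourOnes R π x ≡ 1 ⊎ recolourOnes R π y ≡ 1
  recolourOnes-covers R π cover x y e = map (≡1 x) (≡1 y) (cover x y e)
    where
    ≡1 : ∀ x → T (R x) → recolourOnes R π x ≡ 1
    ≡1 x r with R x
    ... | true = refl

  recolourOnes-packing : ∀ {k π R} → IsPackingColouring E k π → (∀ x → π x ≡ 1 → T (R x)) →
                         (∀ x y → E x y → T (R x) → ¬ T (R y)) →
                         IsPackingColouring E k (recolourOnes R π)
  recolourOnes-packing {k} {π} {R} (bounds , apart) ones⊆R independent = bounds′ , apart′
    where
    bounds′ : ∀ x → 1 ≤ recolourOnes R π x × recolourOnes R π x ≤ k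
    bounds′ x with R x
    ... | true  = ≤-refl , ≤-trans (proj₁ (bounds x)) (proj₂ (bounds x))
    ... | false = bounds x

    apart′ : ∀ x y → x ≢ y → recolourOnes R π x ≡ recolourOnes R π y →
             ¬ DistLe E x y (recolourOnes R π x)
    apart′ x y x≢y same dist with R x in Rx | R y in Ry
    ... | true  | true  = independent x y (dist≤1⇒adjacent x≢y dist) (from T-≡ Rx) (from T-≡ Ry)
    ... | true  | false = subst T Ry (ones⊆R y (sym same))
    ... | false | true  = subst T Rx (ones⊆R x same)
    ... | false | false = apart x y x≢y same dist

module Cycle (n : ℕ) .{{_ : NonZero n}} where
  open ≡-Reasoning

  next : Fin n → Fin n
  next i = suc (toℕ i) mod n

  rotate : ℕ → Fin n → Fin n
  rotate zero    i = i
  rotate (suc k) i = rotate k (next i)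

  prev : Fin n → Fin n
  prev = rotate (pred n)

  toℕ-next : ∀ i → toℕ (next i) ≡ suc (toℕ i) % n
  toℕ-next i = toℕ-fromℕ< (m%n<n (suc (toℕ i)) n)

  [m%n+k]%n≡[m+k]%n : ∀ a k → (a % n + k) % n ≡ (a + k) % n
  [m%n+k]%n≡[m+k]%n a k = begin
    (a % n + k) % n           ≡⟨ %-distribˡ-+ (a % n) k n ⟩
    (a % n % n + k % n) % n   ≡⟨ cong (λ b → (b + k % n) % n) (m%n%n≡m%n a n) ⟩
    (a % n + k % n) % n       ≡⟨ %-distribˡ-+ a k n ⟨
    (a + k) % n               ∎

  toℕ-rotate : ∀ k i → toℕ (rotate k i) ≡ (toℕ i + k) % n
  toℕ-rotate zero i = sym (trans (cong (_% n) (+-identityʳ (toℕ i))) (m<n⇒m%n≡m (toℕ<n i)))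
  toℕ-rotate (suc k) i = begin
    toℕ (rotate k (next i))     ≡⟨ toℕ-rotate k (next i) ⟩
    (toℕ (next i) + k) % n      ≡⟨ cong (λ a → (a + k) % n) (toℕ-next i) ⟩
    (suc (toℕ i) % n + k) % n   ≡⟨ [m%n+k]%n≡[m+k]%n (suc (toℕ i)) k ⟩
    (suc (toℕ i) + k) % n       ≡⟨ cong (_% n) (+-suc (toℕ i) k) ⟨
    (toℕ i + suc k) % n         ∎

  rotate-next : ∀ k i → rotate k (next i) ≡ next (rotate k i)
  rotate-next zero    i = refl
  rotate-next (suc k) i = rotate-next k (next i)

  rotate-+ : ∀ j k i → rotate (j + k) i ≡ rotate j (rotate k i)
  rotate-+ zero    k i = refl
  rotate-+ (suc j) k i = trans (rotate-+ j k (next i)) (cong (rotate j) (rotate-next k i))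

  rotate-n : ∀ i → rotate n i ≡ i
  rotate-n i = toℕ-injective (begin
    toℕ (rotate n i)  ≡⟨ toℕ-rotate n i ⟩
    (toℕ i + n) % n   ≡⟨ [m+n]%n≡m%n (toℕ i) n ⟩
    toℕ i % n         ≡⟨ m<n⇒m%n≡m (toℕ<n i) ⟩
    toℕ i             ∎)

  prev-next : ∀ i → prev (next i) ≡ i
  prev-next i = trans (cong (λ k → rotate k i) (suc-pred n)) (rotate-n i)

  next-prev : ∀ i → next (prev i) ≡ i
  next-prev i = trans (sym (rotate-next (pred n) i)) (prev-next i)

  -- A rotation fixing i is by a multiple of n.
  rotate-≢ : ∀ {k} i → 0 < k → k < n → rotate k i ≢ i
  rotate-≢ {k} i 0<k k<n fixed = >⇒∤ {{>-nonZero 0<k}} k<n (divides q (+-cancelˡ-≡ (toℕ i) _ _ (begin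
    toℕ i + k                ≡⟨ m≡m%n+[m/n]*n (toℕ i + k) n ⟩
    (toℕ i + k) % n + q * n  ≡⟨ cong (_+ q * n) (trans (sym (toℕ-rotate k i)) (cong toℕ fixed)) ⟩
    toℕ i + q * n            ∎)))
    where q = (toℕ i + k) / n

  next-succ : ∀ i → CycSucc n i (next i)
  next-succ i with suc (toℕ i) <? n
  ... | yes lt = inj₁ (sym (trans (toℕ-next i) (m<n⇒m%n≡m lt)))
  ... | no  ge = inj₂ (wraps , trans (toℕ-next i) (trans (cong (_% n) wraps) (n%n≡0 n)))
    where wraps = ≤-antisym (toℕ<n i) (≮⇒≥ ge)

  succ⇒next : ∀ {i j} → CycSucc n i j → j ≡ next i
  succ⇒next {i} {j} (inj₁ eq) = toℕ-injective (trans (sym eq)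
    (sym (trans (toℕ-next i) (m<n⇒m%n≡m (subst (_< n) (sym eq) (toℕ<n j))))))
  succ⇒next {i} (inj₂ (wraps , j≡0)) =
    toℕ-injective (trans j≡0 (sym (trans (toℕ-next i) (trans (cong (_% n) wraps) (n%n≡0 n)))))

-- The colours of (u_i , v_i).
Column : Set
Column = ℕ × ℕ

side : Bool → Column → ℕ
side false = proj₁
side true  = proj₂

colours : List ℕ
colours = applyUpTo suc 5

colour∈colours : ∀ {a} → 1 ≤ a → a ≤ 5 → a ∈ colours
colour∈colours {suc a} _ a<5 = ∈-applyUpTo⁺ suc a<5

-- Packing violations between two rungs at distance d.
columnsClash : ℕ → Column → Column → Bool
columnsClash d (a , b) (a′ , b′) =
  clash d a a′ ∨ clash d b b′ ∨ clash (suc d) a b′ ∨ clash (suc d) b a′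

-- The rungs in the list lie at distances d, d + 1, … behind the given one.
clashesWith : ℕ → Column → List Column → Bool
clashesWith d c []        = false
clashesWith d c (c′ ∷ cs) = columnsClash d c c′ ∨ clashesWith (suc d) c cs

conflicts : Column → List Column → Bool
conflicts (a , b) past = clash 1 a b ∨ clashesWith 1 (a , b) past

isFree : (own across back forth : ℕ) → Bool
isFree own across back forth = (own ≡ᵇ 1) ∨ not ((across ≡ᵇ 1) ∨ (back ≡ᵇ 1) ∨ (forth ≡ᵇ 1))

freeIn : Bool → Column → Column → Column → Bool
freeIn s l c r = isFree (side s c) (side (not s) c) (side s l) (side s r)

rungSplits : Column → Column → Column → Bool
rungSplits l c r = freeIn false l c r xor freeIn true l c r

rowSplits : Bool → Column → Column → Column → Column → Bool
rowSplits s l c r r′ = freeIn s l c r xor freeIn s c r r′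

splitsEdges : Column → Column → Column → Column → Bool
splitsEdges l c r r′ = rungSplits l c r ∧ rowSplits false l c r r′ ∧ rowSplits true l c r r′

splitsEdges⇒ : ∀ l c r r′ → T (splitsEdges l c r r′) →
               T (rungSplits l c r) × (∀ s → T (rowSplits s l c r r′))
splitsEdges⇒ l c r r′ t = proj₁ (to T-∧ t) , λ { false → proj₁ rows ; true → proj₂ rows }
  where
  rows = to T-∧ (proj₂ (to (T-∧ {rungSplits l c r}) t))

-- On eight rungs, most recent first; shorter windows leave too little context for the check to hold.
splitsMiddle : List Column → Bool
splitsMiddle (_ ∷ _ ∷ _ ∷ r′ ∷ r ∷ c ∷ l ∷ _ ∷ []) = splitsEdges l c r r′
splitsMiddle _                                     = false

open Backtracking (cartesianProduct colours colours) conflicts splitsMiddle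

search-succeeds : T (search 8 [])
search-succeeds = tt

module Ladder {n : ℕ} .{{_ : NonZero n}} (5<n : 5 < n) {π : CLVertex n → ℕ}
              (packing : IsPackingColouring (CLAdj n) 5 π) where
  open Cycle n

  along : ∀ s k i → Walk (CLAdj n) (s , i) (s , rotate k i) k
  along s zero    i = here
  along s (suc k) i = step (fwd (next-succ i)) (along s k (next i))

  row-¬clash : ∀ s d z → ¬ T (clash (suc d) (π (s , rotate (suc d) z)) (π (s , z)))
  row-¬clash s d z c = packing⇒¬clash packing distinct (along s (suc d) z) c
    where
    d<n = ≤-<-trans (≤-trans (clash⇒≤ c) (proj₂ (proj₁ packing _))) 5<n
    distinct : (s , rotate (suc d) z) ≢ (s , z)
    distinct = rotate-≢ z z<s d<n ∘ cong proj₂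

  rung-¬clash : ∀ s d z → ¬ T (clash (suc (suc d)) (π (s , rotate (suc d) z)) (π (not s , z)))
  rung-¬clash s d z = packing⇒¬clash packing (not-¬ refl ∘ cong proj₁)
                        (step (rung (not-¬ refl ∘ sym)) (along s (suc d) z))

  column : Fin n → Column
  column i = π (false , i) , π (true , i)

  side-column : ∀ s i → side s (column i) ≡ π (s , i)
  side-column false i = refl
  side-column true  i = refl

  column∈candidates : ∀ i → column i ∈ cartesianProduct colours colours
  column∈candidates i = ∈-cartesianProduct⁺ (in-range (false , i)) (in-range (true , i))
    where in-range = λ x → colour∈colours (proj₁ (proj₁ packing x)) (proj₂ (proj₁ packing x))

  columns-¬clash : ∀ d z → ¬ T (columnsClash (suc d) (column (rotate (suc d) z)) (column z))
  columns-¬clash d z = ¬-∨ (row-¬clash false d z) (¬-∨ (row-¬clash true d z)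
                         (¬-∨ (rung-¬clash false d z) (rung-¬clash true d z)))

  window : Fin n → ℕ → Column
  window z j = column (rotate j z)

  window-¬clashesWith : ∀ z q d → ¬ T (clashesWith (suc d) (window z (d + q)) (history (window z) q))
  window-¬clashesWith z zero    d = λ ()
  window-¬clashesWith z (suc q) d rewrite +-suc d q =
    ¬-∨ (subst (λ c → ¬ T (columnsClash (suc d) c (window z q)))
               (cong column (sym (rotate-+ (suc d) q z))) (columns-¬clash d (rotate q z)))
        (window-¬clashesWith z q (suc d))

  window-¬conflicts : ∀ z p → ¬ T (conflicts (window z p) (history (window z) p))
  window-¬conflicts z p = ¬-∨ (packing⇒¬clash packing (λ ()) (step (rung (λ ())) here))
                              (window-¬clashesWith z p 0)

  SplitsAround : Fin n → Fin n → Set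
  SplitsAround i j = T (splitsEdges (column i) (column j) (column (next j)) (column (next (next j))))

  window-splits : ∀ z → SplitsAround (next z) (next (next z))
  window-splits z = search-sound (window z) (λ p → column∈candidates (rotate p z))
                      (window-¬conflicts z) 8 0 search-succeeds

  free : CLVertex n → Bool
  free (s , i) = freeIn s (column (prev i)) (column i) (column (next i))

  one⇒free : ∀ x → π x ≡ 1 → T (free x)
  one⇒free (s , i) one = from T-∨ (inj₁ (≡⇒≡ᵇ _ 1 (trans (side-column s i) one)))

  edges-split : ∀ i →
    T (rungSplits (column (prev i)) (column i) (column (next i))) ×
    (∀ s → T (rowSplits s (column (prev i)) (column i) (column (next i)) (column (next (next i)))))
  edges-split i =
    splitsEdges⇒ (column (prev i)) (column i) (column (next i)) (column (next (next i)))
      (subst₂ SplitsAround (next-prev (prev i)) (trans (cong next (next-prev (prev i))) (next-prev i))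
        (window-splits (prev (prev i))))

  row-split : ∀ s i → T (free (s , i) xor free (s , next i))
  row-split s i = subst (λ j → T (free (s , i) xor freeIn s (column j) (column (next i)) (column (next (next i)))))
                        (sym (prev-next i)) (proj₂ (edges-split i) s)

  adjacent-split : ∀ x y → CLAdj n x y → T (free x xor free y)
  adjacent-split (false , i) (true  , .i) (rung _)  = proj₁ (edges-split i)
  adjacent-split (true  , i) (false , .i) (rung _)  =
    subst T (xor-comm (free (false , i)) (free (true , i))) (proj₁ (edges-split i))
  adjacent-split (false , i) (false , .i) (rung ne) = ⊥-elim (ne refl)
  adjacent-split (true  , i) (true  , .i) (rung ne) = ⊥-elim (ne refl)
  adjacent-split (s , i) (.s , j) (fwd succ) rewrite succ⇒next succ = row-split s i
  adjacent-split (s , i) (.s , j) (bwd succ) rewrite succ⇒next succ =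
    subst T (xor-comm (free (s , j)) (free (s , next j))) (row-split s j)

corollary6 : (n : ℕ) → 6 ≤ n → ChiRhoLe (CLAdj n) 5 →
    Σ (CLVertex n → ℕ) λ π → IsPackingColouring (CLAdj n) 5 π ×
      ((x y : CLVertex n) → CLAdj n x y → (π x ≡ 1) ⊎ (π y ≡ 1))
corollary6 n@(suc _) 6≤n (_ , k≤5 , π , packing) =
  recolourOnes free π ,
  recolourOnes-packing {R = free} packing₅ one⇒free independent ,
  recolourOnes-covers free π (λ x y e → xor⇒⊎ (free x) (free y) (adjacent-split x y e))
  where
  packing₅ = packing-mono k≤5 packing
  open Ladder 6≤n packing₅

  independent : ∀ x y → CLAdj n x y → T (free x) → ¬ T (free y)
  independent x y e = xor⇒¬both (free x) (free y) (adjacent-split x y e)
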